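{- Let $\{H_1,\ldots,H_f\}$ be a set of $f$ mutually quasi-unbiased Hadamard matrices of order $n$ with parameters $(l,a)$, and let $\{K_1,\ldots,K_f\}$ be a set of $f$ mutually quasi-unbiased Hadamard matrices of order $n'$ with parameters $(l',a')$. Then $\{H_1\otimes K_1,\ldots,H_f\otimes K_f\}$ is a set of $f$ mutually quasi-unbiased Hadamard matrices of order $nn'$ with parameters $(ll',aa')$.
   Context: A Hadamard matrix of order $n$ is an $n\times n$ $(\pm1)$-matrix $H$ with $HH^T=nI_n$. A weighing matrix of order $n$ and weight $k$ is an $n\times n$ $(1,-1,0)$-matrix $W$ with $WW^T=kI_n$. Hadamard matrices $H,K$ of order $n$ are quasi-unbiased with parameters $(l,a)$ if $\frac1{\sqrt a}HK^T$ is a weighing matrix of weight $l$; a set is mutually quasi-unbiased if every pair of distinct members is. $\otimes$ denotes the Kronecker product. -}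

module Defs where

open import Data.Nat using (ℕ; zero; suc) renaming (_*_ to _*ℕ_)
open import Data.Integer using (ℤ; +_; -_; 0ℤ; 1ℤ; _+_; _*_; _≤_)
open import Data.Fin using (Fin; zero; suc; remQuot; _≟_)
open import Relation.Nullary using (yes; no)
open import Data.Product using (_×_; proj₁; proj₂; ∃)
open import Data.Sum using (_⊎_)
open import Relation.Binary.PropositionalEquality using (_≡_; _≢_)

Matrix : ℕ → Set
Matrix n = Fin n → Fin n → ℤ

∑ : ∀ {n} → (Fin n → ℤ) → ℤ
∑ {zero}  f = 0ℤ
∑ {suc n} f = f zero + ∑ (λ k → f (suc k))

_·ᵀ_ : ∀ {n} → Matrix n → Matrix n → Matrix n
(M ·ᵀ N) i j = ∑ (λ k → M i k * N j k)

scalarId : ∀ {n} → ℤ → Matrix n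
scalarId {n} c i j with i ≟ j
... | yes _ = c
... | no _  = 0ℤ

_≐_ : ∀ {n} → Matrix n → Matrix n → Set
M ≐ N = ∀ i j → M i j ≡ N i j

IsHadamard : ∀ n → Matrix n → Set
IsHadamard n H = (∀ i j → (H i j ≡ 1ℤ) ⊎ (H i j ≡ - 1ℤ)) × ((H ·ᵀ H) ≐ scalarId (+ n))

IsWeighing : ∀ n → ℕ → Matrix n → Set
IsWeighing n k W =
  (∀ i j → (W i j ≡ 1ℤ) ⊎ ((W i j ≡ - 1ℤ) ⊎ (W i j ≡ 0ℤ))) × ((W ·ᵀ W) ≐ scalarId (+ k))

-- M = √a · W  (a > 0), expressed without square roots:
-- entrywise M_ij² = a·W_ij² and M_ij, W_ij have the same sign.
IsSqrtMultiple : ∀ {n} → ℕ → Matrix n → Matrix n → Set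
IsSqrtMultiple a M W =
  ∀ i j → (M i j * M i j ≡ + a * (W i j * W i j)) × (0ℤ ≤ M i j * W i j)

-- H, K quasi-unbiased with parameters (l, a):
-- (1/√a) H Kᵀ is a weighing matrix of weight l  (a a positive integer)
QuasiUnbiased : ∀ n → ℕ → ℕ → Matrix n → Matrix n → Set
QuasiUnbiased n l a H K =
  a ≢ 0 × ∃ λ (W : Matrix n) → IsWeighing n l W × IsSqrtMultiple a (H ·ᵀ K) W

MutuallyQU : ∀ (f n l a : ℕ) → (Fin f → Matrix n) → Set
MutuallyQU f n l a H =
  (∀ i → IsHadamard n (H i)) × (∀ i j → i ≢ j → QuasiUnbiased n l a (H i) (H j))

-- Kronecker product; index of H ⊗ K at row (i,i'), column (j,j') is H i j · K i' j',
-- with Fin (n * n') ≅ Fin n × Fin n' via the standard combine/remQuot.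
_⊗_ : ∀ {n n'} → Matrix n → Matrix n' → Matrix (n *ℕ n')
_⊗_ {n} {n'} H K r c =
  H (proj₁ (remQuot {n} n' r)) (proj₁ (remQuot {n} n' c)) * K (proj₂ (remQuot {n} n' r)) (proj₂ (remQuot {n} n' c))

-- Everything is multiplicative under the Kronecker product: by the mixed-product rule
-- (A ⊗ C)(B ⊗ D)ᵀ = ABᵀ ⊗ CDᵀ, so Gram matrices c·I, d·I give cd·I; entries in {±1} or
-- {0, ±1} stay there; and if HKᵀ = √a·W and H'K'ᵀ = √a'·W' then (H ⊗ H')(K ⊗ K')ᵀ = √(aa')·(W ⊗ W').
module Submission where

open import Defs
open import Data.Nat using (ℕ; zero; suc; _*_; z≤n) renaming (_+_ to _+ℕ_)
open import Data.Nat.Properties using (m*n≡0⇒m≡0∨n≡0)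
open import Data.Fin using (Fin; zero; suc; _↑ˡ_; _↑ʳ_; combine; remQuot; _≟_)
open import Data.Fin.Properties using (remQuot-combine; combine-remQuot)
open import Data.Integer using (ℤ; +_; -_; 0ℤ; 1ℤ; _+_; _≤_; +≤+)
  renaming (_*_ to _*ℤ_)
open import Data.Integer.Properties
  using (+-identityˡ; +-assoc; *-zeroˡ; *-zeroʳ; *-comm; *-distribˡ-+; pos-*; *-commutativeSemigroup)
open import Algebra.Properties.CommutativeSemigroup *-commutativeSemigroup using (interchange)
open import Data.Product using (_×_; _,_; proj₁; proj₂)
open import Data.Sum using (_⊎_; inj₁; inj₂; [_,_])
open import Function using (_∘_; case_of_)
open import Relation.Nullary using (yes; no)
open import Data.Empty using (⊥-elim)
open import Relation.Binary.PropositionalEquality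
  using (_≡_; _≢_; refl; sym; trans; cong; cong₂; subst; module ≡-Reasoning)
open ≡-Reasoning

∑-cong : ∀ {n} {f g : Fin n → ℤ} → (∀ i → f i ≡ g i) → ∑ f ≡ ∑ g
∑-cong {zero}  f≗g = refl
∑-cong {suc n} f≗g = cong₂ _+_ (f≗g zero) (∑-cong (f≗g ∘ suc))

∑-*ˡ : ∀ {n} c (f : Fin n → ℤ) → ∑ (λ k → c *ℤ f k) ≡ c *ℤ ∑ f
∑-*ˡ {zero}  c f = sym (*-zeroʳ c)
∑-*ˡ {suc n} c f = trans (cong (_+_ (c *ℤ f zero)) (∑-*ˡ c (f ∘ suc))) (sym (*-distribˡ-+ c _ _))

∑-*ʳ : ∀ {n} c (f : Fin n → ℤ) → ∑ (λ k → f k *ℤ c) ≡ ∑ f *ℤ c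
∑-*ʳ c f = trans (∑-cong (λ k → *-comm (f k) c)) (trans (∑-*ˡ c f) (*-comm c _))

∑-↑ : ∀ m n (f : Fin (m +ℕ n) → ℤ) → ∑ f ≡ ∑ (λ i → f (i ↑ˡ n)) + ∑ (λ j → f (m ↑ʳ j))
∑-↑ zero    n f = sym (+-identityˡ _)
∑-↑ (suc m) n f = trans (cong (_+_ (f zero)) (∑-↑ m n (f ∘ suc))) (sym (+-assoc (f zero) _ _))

∑-combine : ∀ m n (f : Fin (m * n) → ℤ) → ∑ f ≡ ∑ {m} (λ i → ∑ {n} (λ j → f (combine i j)))
∑-combine zero    n f = refl
∑-combine (suc m) n f =
  trans (∑-↑ n (m * n) f) (cong (_+_ (∑ (λ j → f (j ↑ˡ (m * n))))) (∑-combine m n (f ∘ (n ↑ʳ_))))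

scalarId-diag : ∀ {n} c (i : Fin n) → scalarId c i i ≡ c
scalarId-diag c i with i ≟ i
... | yes _   = refl
... | no i≢i = ⊥-elim (i≢i refl)

scalarId-offdiag : ∀ {n} c {i j : Fin n} → i ≢ j → scalarId c i j ≡ 0ℤ
scalarId-offdiag c {i} {j} i≢j with i ≟ j
... | yes i≡j = ⊥-elim (i≢j i≡j)
... | no _    = refl

IsSign : ℤ → Set
IsSign x = (x ≡ 1ℤ) ⊎ (x ≡ - 1ℤ)

IsSignOrZero : ℤ → Set
IsSignOrZero x = (x ≡ 1ℤ) ⊎ ((x ≡ - 1ℤ) ⊎ (x ≡ 0ℤ))

IsSign-* : ∀ {x y} → IsSign x → IsSign y → IsSign (x *ℤ y)
IsSign-* (inj₁ refl) (inj₁ refl) = inj₁ refl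
IsSign-* (inj₁ refl) (inj₂ refl) = inj₂ refl
IsSign-* (inj₂ refl) (inj₁ refl) = inj₂ refl
IsSign-* (inj₂ refl) (inj₂ refl) = inj₁ refl

IsSignOrZero-* : ∀ {x y} → IsSignOrZero x → IsSignOrZero y → IsSignOrZero (x *ℤ y)
IsSignOrZero-* (inj₂ (inj₂ refl)) _                  = inj₂ (inj₂ refl)
IsSignOrZero-* {x} _              (inj₂ (inj₂ refl)) = inj₂ (inj₂ (*-zeroʳ x))
IsSignOrZero-* (inj₁ refl)        (inj₁ refl)        = inj₁ refl
IsSignOrZero-* (inj₁ refl)        (inj₂ (inj₁ refl)) = inj₂ (inj₁ refl)
IsSignOrZero-* (inj₂ (inj₁ refl)) (inj₁ refl)        = inj₂ (inj₁ refl)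
IsSignOrZero-* (inj₂ (inj₁ refl)) (inj₂ (inj₁ refl)) = inj₁ refl

*-pres-0≤ : ∀ {x y} → 0ℤ ≤ x → 0ℤ ≤ y → 0ℤ ≤ x *ℤ y
*-pres-0≤ {+ a} {+ b} _ _ = subst (0ℤ ≤_) (pos-* a b) (+≤+ z≤n)

SqrtMultiple : ℕ → ℤ → ℤ → Set
SqrtMultiple a x w = (x *ℤ x ≡ + a *ℤ (w *ℤ w)) × (0ℤ ≤ x *ℤ w)

SqrtMultiple-* : ∀ {a b} x y v w → SqrtMultiple a x v → SqrtMultiple b y w → SqrtMultiple (a * b) (x *ℤ y) (v *ℤ w)
SqrtMultiple-* {a} {b} x y v w (x²≡av² , 0≤xv) (y²≡bw² , 0≤yw) = square , sign
  where
  square : (x *ℤ y) *ℤ (x *ℤ y) ≡ + (a * b) *ℤ ((v *ℤ w) *ℤ (v *ℤ w))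
  square = begin
    (x *ℤ y) *ℤ (x *ℤ y)                      ≡⟨ interchange x y x y ⟩
    (x *ℤ x) *ℤ (y *ℤ y)                      ≡⟨ cong₂ _*ℤ_ x²≡av² y²≡bw² ⟩
    (+ a *ℤ (v *ℤ v)) *ℤ (+ b *ℤ (w *ℤ w))    ≡⟨ interchange (+ a) (v *ℤ v) (+ b) (w *ℤ w) ⟩
    (+ a *ℤ + b) *ℤ ((v *ℤ v) *ℤ (w *ℤ w))    ≡⟨ cong₂ _*ℤ_ (pos-* a b) (interchange v w v w) ⟨
    + (a * b) *ℤ ((v *ℤ w) *ℤ (v *ℤ w))       ∎
  sign : 0ℤ ≤ (x *ℤ y) *ℤ (v *ℤ w)
  sign = subst (0ℤ ≤_) (interchange x v y w) (*-pres-0≤ 0≤xv 0≤yw)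

module _ {m n : ℕ} where

  outer : Fin (m * n) → Fin m
  outer r = proj₁ (remQuot {m} n r)

  inner : Fin (m * n) → Fin n
  inner r = proj₂ (remQuot {m} n r)

  ∑-remQuot : (F : Fin m → Fin n → ℤ) → ∑ (λ r → F (outer r) (inner r)) ≡ ∑ (λ i → ∑ (λ j → F i j))
  ∑-remQuot F = trans (∑-combine m n _)
    (∑-cong λ i → ∑-cong λ j → cong (λ p → F (proj₁ p) (proj₂ p)) (remQuot-combine i j))

  outer-inner-injective : ∀ {r c} → outer r ≡ outer c → inner r ≡ inner c → r ≡ c
  outer-inner-injective {r} {c} o≡ i≡ = begin
    r                             ≡⟨ combine-remQuot {m} n r ⟨
    combine (outer r) (inner r)   ≡⟨ cong₂ combine o≡ i≡ ⟩
    combine (outer c) (inner c)   ≡⟨ combine-remQuot {m} n c ⟩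
    c                             ∎

  ⊗-·ᵀ : (A B : Matrix m) (C D : Matrix n) → ((A ⊗ C) ·ᵀ (B ⊗ D)) ≐ ((A ·ᵀ B) ⊗ (C ·ᵀ D))
  ⊗-·ᵀ A B C D r c = begin
    ∑ (λ k → (A i (outer k) *ℤ C i' (inner k)) *ℤ (B j (outer k) *ℤ D j' (inner k)))
      ≡⟨ ∑-remQuot (λ x y → (A i x *ℤ C i' y) *ℤ (B j x *ℤ D j' y)) ⟩
    ∑ (λ x → ∑ (λ y → (A i x *ℤ C i' y) *ℤ (B j x *ℤ D j' y)))
      ≡⟨ ∑-cong (λ x → ∑-cong (λ y → interchange (A i x) (C i' y) (B j x) (D j' y))) ⟩
    ∑ (λ x → ∑ (λ y → (A i x *ℤ B j x) *ℤ (C i' y *ℤ D j' y)))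
      ≡⟨ ∑-cong (λ x → ∑-*ˡ (A i x *ℤ B j x) (λ y → C i' y *ℤ D j' y)) ⟩
    ∑ (λ x → (A i x *ℤ B j x) *ℤ (C ·ᵀ D) i' j')
      ≡⟨ ∑-*ʳ ((C ·ᵀ D) i' j') (λ x → A i x *ℤ B j x) ⟩
    (A ·ᵀ B) i j *ℤ (C ·ᵀ D) i' j'
      ∎
    where
    i = outer r
    j = outer c
    i' = inner r
    j' = inner c

  scalarId-⊗ : ∀ x y → (scalarId {m} x ⊗ scalarId {n} y) ≐ scalarId (x *ℤ y)
  scalarId-⊗ x y r c with r ≟ c
  ... | yes refl = cong₂ _*ℤ_ (scalarId-diag x (outer r)) (scalarId-diag y (inner r))
  ... | no r≢c   = offdiag
    where
    offdiag : scalarId x (outer r) (outer c) *ℤ scalarId y (inner r) (inner c) ≡ 0ℤ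
    offdiag = case outer r ≟ outer c of λ where
      (no o≢)  → trans (cong (_*ℤ scalarId y (inner r) (inner c)) (scalarId-offdiag x o≢))
                        (*-zeroˡ (scalarId y (inner r) (inner c)))
      (yes o≡) → trans (cong (scalarId x (outer r) (outer c) *ℤ_) (scalarId-offdiag y (r≢c ∘ outer-inner-injective o≡)))
                        (*-zeroʳ (scalarId x (outer r) (outer c)))

  ⊗-gram : ∀ {a b} (M : Matrix m) (N : Matrix n) → (M ·ᵀ M) ≐ scalarId (+ a) → (N ·ᵀ N) ≐ scalarId (+ b)
         → ((M ⊗ N) ·ᵀ (M ⊗ N)) ≐ scalarId (+ (a * b))
  ⊗-gram {a} {b} M N MMᵀ NNᵀ r c = begin
    ((M ⊗ N) ·ᵀ (M ⊗ N)) r c                                        ≡⟨ ⊗-·ᵀ M M N N r c ⟩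
    (M ·ᵀ M) (outer r) (outer c) *ℤ (N ·ᵀ N) (inner r) (inner c)    ≡⟨ cong₂ _*ℤ_ (MMᵀ _ _) (NNᵀ _ _) ⟩
    (scalarId {m} (+ a) ⊗ scalarId {n} (+ b)) r c                   ≡⟨ scalarId-⊗ (+ a) (+ b) r c ⟩
    scalarId (+ a *ℤ + b) r c                                       ≡⟨ cong (λ x → scalarId x r c) (pos-* a b) ⟨
    scalarId (+ (a * b)) r c                                        ∎

  IsSqrtMultiple-⊗ : ∀ a b (M W : Matrix m) (M' W' : Matrix n)
                   → IsSqrtMultiple a M W → IsSqrtMultiple b M' W' → IsSqrtMultiple (a * b) (M ⊗ M') (W ⊗ W')
  IsSqrtMultiple-⊗ a b M W M' W' sqrt sqrt' r c =
    SqrtMultiple-* {a} {b} (M i j) (M' i' j') (W i j) (W' i' j') (sqrt i j) (sqrt' i' j')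
    where
    i = outer r
    j = outer c
    i' = inner r
    j' = inner c

  IsHadamard-⊗ : ∀ (H : Matrix m) (K : Matrix n) → IsHadamard m H → IsHadamard n K → IsHadamard (m * n) (H ⊗ K)
  IsHadamard-⊗ H K (signH , gramH) (signK , gramK) =
    (λ r c → IsSign-* (signH (outer r) (outer c)) (signK (inner r) (inner c))) , ⊗-gram H K gramH gramK

  IsWeighing-⊗ : ∀ {k k'} (W : Matrix m) (W' : Matrix n)
               → IsWeighing m k W → IsWeighing n k' W' → IsWeighing (m * n) (k * k') (W ⊗ W')
  IsWeighing-⊗ W W' (entriesW , gramW) (entriesW' , gramW') =
    (λ r c → IsSignOrZero-* (entriesW (outer r) (outer c)) (entriesW' (inner r) (inner c))) ,
    ⊗-gram W W' gramW gramW'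

  QuasiUnbiased-⊗ : ∀ {l a l' a'} (H K : Matrix m) (H' K' : Matrix n)
                  → QuasiUnbiased m l a H K → QuasiUnbiased n l' a' H' K'
                  → QuasiUnbiased (m * n) (l * l') (a * a') (H ⊗ H') (K ⊗ K')
  QuasiUnbiased-⊗ {a = a} {a' = a'} H K H' K' (a≢0 , W , weighW , sqrtW) (a'≢0 , W' , weighW' , sqrtW') =
    [ a≢0 , a'≢0 ] ∘ m*n≡0⇒m≡0∨n≡0 a , W ⊗ W' , IsWeighing-⊗ W W' weighW weighW' , sqrt
    where
    sqrt : IsSqrtMultiple (a * a') ((H ⊗ H') ·ᵀ (K ⊗ K')) (W ⊗ W')
    sqrt r c = subst (λ x → SqrtMultiple (a * a') x ((W ⊗ W') r c)) (sym (⊗-·ᵀ H K H' K' r c))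
                     (IsSqrtMultiple-⊗ a a' (H ·ᵀ K) W (H' ·ᵀ K') W' sqrtW sqrtW' r c)

proposition4p6 : (f n n' l a l' a' : ℕ) (H : Fin f → Matrix n) (K : Fin f → Matrix n')
                 → MutuallyQU f n l a H → MutuallyQU f n' l' a' K
                 → MutuallyQU f (n * n') (l * l') (a * a') (λ i → H i ⊗ K i)
proposition4p6 f n n' l a l' a' H K (hadamardH , unbiasedH) (hadamardK , unbiasedK) =
  (λ i → IsHadamard-⊗ (H i) (K i) (hadamardH i) (hadamardK i)) ,
  (λ i j i≢j → QuasiUnbiased-⊗ (H i) (H j) (K i) (K j) (unbiasedH i j i≢j) (unbiasedK i j i≢j))
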